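{- Every hereditarily meager filter on $\omega$ is both completely meager and weakly hereditarily meager.
   Context: A filter on $\omega$ is a family of subsets of $\omega$ closed under finite intersections and supersets and containing all cofinite sets; it is proper if it contains only infinite sets. $\mathcal F^+=\{X\subseteq\omega:\omega\setminus X\notin\mathcal F\}$. Subsets of $\omega$ are identified with characteristic functions in $2^\omega$ (product topology), and "meager" refers to this topology. For $f\in{}^\omega\omega$, $f(\mathcal F)=\{Y\subseteq\omega:f^{ -1}(Y)\in\mathcal F\}$. $\mathcal F$ is hereditarily meager if for every $f\in{}^\omega\omega$, $f(\mathcal F)$ is meager or improper. $\mathcal F$ is completely meager if the filter generated by $\mathcal F\cup\{X\}$ is meager whenever $X\in\mathcal F^+$. $\mathcal F$ is weakly hereditarily meager if for every $f\in{}^\omega\omega$, either $f^{ -1}(\{i\})\in\mathcal F^+$ for some $i$, or $f(\mathcal F)$ is meager. -}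

module Defs where

open import Data.Nat using (ℕ; zero; suc; _≤_; _≡ᵇ_)
open import Data.Bool using (Bool; true; false; not; _∧_)
open import Data.List using (List; []; _∷_; _++_)
open import Data.Product using (Σ; _×_; ∃; ∃-syntax; _,_)
open import Data.Sum using (_⊎_)
open import Data.Unit using (⊤)
open import Relation.Nullary using (¬_; Dec)
open import Relation.Binary.PropositionalEquality using (_≡_)

-- A subset of ω, identified with its characteristic function (a point of 2^ω).
Subset : Set
Subset = ℕ → Bool

Family : Set₁
Family = Subset → Set

_⊆_ : Subset → Subset → Set
X ⊆ Y = ∀ n → X n ≡ true → Y n ≡ true

_∩_ : Subset → Subset → Subset
(X ∩ Y) n = X n ∧ Y n

complement : Subset → Subset
complement X n = not (X n)

singleton : ℕ → Subset
singleton i n = n ≡ᵇ i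

Cofinite : Subset → Set
Cofinite X = ∃[ N ] (∀ n → N ≤ n → X n ≡ true)

Infinite : Subset → Set
Infinite X = ∀ N → ∃[ n ] (N ≤ n × X n ≡ true)

record IsFilter (F : Family) : Set where
  field
    ∩-closed : ∀ X Y → F X → F Y → F (X ∩ Y)
    ⊇-closed : ∀ X Y → F X → X ⊆ Y → F Y
    cofinite : ∀ X → Cofinite X → F X

Proper : Family → Set
Proper F = ∀ X → F X → Infinite X

Positive : Family → Subset → Set
Positive F X = ¬ F (complement X)

preimage : (ℕ → ℕ) → Subset → Subset
preimage f Y n = Y (f n)

image : (ℕ → ℕ) → Family → Family
image f F Y = F (preimage f Y)

generated : Family → Subset → Family
generated F X Y = ∃[ Z ] (F Z × (Z ∩ X) ⊆ Y)

-- x extends the finite binary string s (x lies in the basic open set [s]).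
Extends : Subset → List Bool → Set
Extends x [] = ⊤
Extends x (b ∷ s) = (x 0 ≡ b) × Extends (λ n → x (suc n)) s

-- D ⊆ 2^ω is nowhere dense: every basic open [s] contains a basic open [s ++ t]
-- disjoint from D (equivalently from the closure of D).
NowhereDense : Family → Set
NowhereDense D = ∀ (s : List Bool) → ∃[ t ] (∀ x → D x → ¬ Extends x (s ++ t))

Meager : Family → Set₁
Meager A = Σ (ℕ → Family) λ D → (∀ k → NowhereDense (D k)) × (∀ x → A x → ∃[ k ] D k x)

HereditarilyMeager : Family → Set₁
HereditarilyMeager F = ∀ (f : ℕ → ℕ) → Meager (image f F) ⊎ ¬ Proper (image f F)

CompletelyMeager : Family → Set₁
CompletelyMeager F = ∀ X → Positive F X → Meager (generated F X)

WeaklyHereditarilyMeager : Family → Set₁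
WeaklyHereditarilyMeager F =
  ∀ (f : ℕ → ℕ) → (∃[ i ] Positive F (preimage f (singleton i))) ⊎ Meager (image f F)

-- Classical ambient logic (the paper works in ZFC).
ExcludedMiddle : Set₁
ExcludedMiddle = (P : Set) → Dec P

-- If X is positive, the map sending X identically to itself and everything
-- else to 0 pushes F forward to a proper filter, since a bounded member of the
-- image would put ω ∖ X into F.  By hereditary meagerness that image is
-- meager, and the filter generated by F ∪ {X} maps into it under the
-- continuous map that sets the bit at 0, so it is meager too.
-- If no fibre of f is positive, every complement of a fibre lies in F, hence
-- so does f⁻¹[N, ∞) for each N; then every member of f(F) is unbounded, so
-- f(F) is proper and therefore meager.
module Submission where

open import Defs
open import Data.Bool using (Bool; true; false; _∧_; if_then_else_)
open import Data.Bool.Properties using (T-≡; ∧-conicalˡ; ∧-conicalʳ)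
open import Data.Empty using (⊥-elim)
open import Data.List using ([]; _∷_; _++_)
open import Data.Nat using (ℕ; zero; suc; _≤_; _≤ᵇ_; _≡ᵇ_)
open import Data.Nat.Properties using (≤ᵇ⇒≤; ≤⇒≤ᵇ; ≡⇒≡ᵇ; ≤∧≢⇒<)
open import Data.Product using (_×_; ∃-syntax; _,_)
open import Data.Sum using (inj₁; inj₂)
open import Function.Bundles using (Equivalence)
open import Relation.Nullary using (¬_; yes; no)
open import Relation.Nullary.Decidable using (decidable-stable)
open import Relation.Binary.PropositionalEquality using (_≡_; _≢_; refl; ≢-sym)

open Equivalence using (to; from)

atLeast : ℕ → Subset
atLeast N n = N ≤ᵇ n

atLeast-cofinite : ∀ N → Cofinite (atLeast N)
atLeast-cofinite N = N , λ n N≤n → to T-≡ (≤⇒≤ᵇ N≤n)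

atLeast⇒≤ : ∀ {N n} → atLeast N n ≡ true → N ≤ n
atLeast⇒≤ {N} {n} e = ≤ᵇ⇒≤ N n (from T-≡ e)

fibre : (ℕ → ℕ) → ℕ → Subset
fibre f i = preimage f (singleton i)

∉singleton⇒≢ : ∀ {m i} → complement (singleton i) m ≡ true → m ≢ i
∉singleton⇒≢ {m} {i} m∉i m≡i with m ≡ᵇ i | ≡⇒≡ᵇ m i m≡i
∉singleton⇒≢ () m≡i | true  | _
∉singleton⇒≢ m∉i m≡i | false | ()

∧-intro : ∀ {a b} → a ≡ true → b ≡ true → (a ∧ b) ≡ true
∧-intro refl refl = refl

infinite-if-unbounded : ExcludedMiddle → ∀ Y →
  (∀ N → ¬ (∀ n → N ≤ n → Y n ≢ true)) → Infinite Y
infinite-if-unbounded em Y unbounded N = decidable-stable (em _) λ none →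
  unbounded N λ n N≤n Yn → none (n , N≤n , Yn)

collapseOutside : Subset → ℕ → ℕ
collapseOutside X n = if X n then n else 0

withHead : Bool → Subset → Subset
withHead b Y zero    = b
withHead b Y (suc n) = Y (suc n)

withHead-extends : ∀ b c x s → Extends x (c ∷ s) → Extends (withHead b x) (b ∷ s)
withHead-extends b c x s (_ , x⊒s) = refl , x⊒s

nowhereDense-preimage-withHead : ∀ b {D} → NowhereDense D →
  NowhereDense (λ Y → D (withHead b Y))
nowhereDense-preimage-withHead b nd [] with nd (b ∷ [])
... | t , avoid = b ∷ t , λ x Dx x⊒bt → avoid (withHead b x) Dx (withHead-extends b b x t x⊒bt)
nowhereDense-preimage-withHead b nd (c ∷ s) with nd (b ∷ s)
... | t , avoid = t , λ x Dx x⊒cst → avoid (withHead b x) Dx (withHead-extends b c x (s ++ t) x⊒cst)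

meager-preimage-withHead : ∀ b {A} → Meager A → Meager (λ Y → A (withHead b Y))
meager-preimage-withHead b (D , nd , cover) =
  (λ k Y → D k (withHead b Y)) , (λ k → nowhereDense-preimage-withHead b (nd k)) ,
  λ Y → cover (withHead b Y)

meager-mono : ∀ {A B : Family} → (∀ x → A x → B x) → Meager B → Meager A
meager-mono A⊆B (D , nd , cover) = D , nd , λ x Ax → cover x (A⊆B x Ax)

module _ {F : Family} (isF : IsFilter F) where
  open IsFilter isF

  image-proper-if-tendsto-∞ : Proper F → ∀ f →
    (∀ N → F (preimage f (atLeast N))) → Proper (image f F)
  image-proper-if-tendsto-∞ prF f tendsto Y FY N
    with prF _ (∩-closed _ _ FY (tendsto N)) 0
  ... | n , _ , e = f n , atLeast⇒≤ (∧-conicalʳ _ _ e) , ∧-conicalˡ _ _ e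

  preimage-atLeast-suc : ∀ f N →
    (preimage f (atLeast N) ∩ complement (fibre f N)) ⊆ preimage f (atLeast (suc N))
  preimage-atLeast-suc f N n e = to T-≡ (≤⇒≤ᵇ (≤∧≢⇒< N≤fn (≢-sym fn≢N)))
    where
    N≤fn : N ≤ f n
    N≤fn = atLeast⇒≤ (∧-conicalˡ _ _ e)
    fn≢N : f n ≢ N
    fn≢N = ∉singleton⇒≢ (∧-conicalʳ (atLeast N (f n)) _ e)

  tendsto-∞-if-fibres-null : ∀ f → (∀ i → F (complement (fibre f i))) →
    ∀ N → F (preimage f (atLeast N))
  tendsto-∞-if-fibres-null f null zero = cofinite _ (0 , λ _ _ → refl)
  tendsto-∞-if-fibres-null f null (suc N) =
    ⊇-closed _ _ (∩-closed _ _ (tendsto-∞-if-fibres-null f null N) (null N))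
      (preimage-atLeast-suc f N)

  image-collapseOutside-proper : ExcludedMiddle → ∀ X → Positive F X →
    Proper (image (collapseOutside X) F)
  image-collapseOutside-proper em X pos Y FY =
    infinite-if-unbounded em Y λ N bounded →
      pos (⊇-closed _ _ (∩-closed _ _ FY (cofinite _ (atLeast-cofinite N)))
             (outsideX bounded))
    where
    outsideX : ∀ {N} → (∀ n → N ≤ n → Y n ≢ true) →
      (preimage (collapseOutside X) Y ∩ atLeast N) ⊆ complement X
    outsideX {N} bounded n e with X n
    ... | false = refl
    ... | true  = ⊥-elim (bounded n (atLeast⇒≤ (∧-conicalʳ _ _ e)) (∧-conicalˡ _ _ e))

  generated⊆image-collapseOutside : ∀ X Y → generated F X Y →
    image (collapseOutside X) F (withHead true Y)
  generated⊆image-collapseOutside X Y (Z , FZ , Z∩X⊆Y) = ⊇-closed Z _ FZ Z⊆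
    where
    Z⊆ : Z ⊆ preimage (collapseOutside X) (withHead true Y)
    Z⊆ n Zn with X n in Xn
    Z⊆ n       Zn | false = refl
    Z⊆ zero    Zn | true  = refl
    Z⊆ (suc n) Zn | true  = Z∩X⊆Y (suc n) (∧-intro Zn Xn)

  completelyMeager : ExcludedMiddle → HereditarilyMeager F → CompletelyMeager F
  completelyMeager em hm X pos with hm (collapseOutside X)
  ... | inj₁ meager   = meager-mono (generated⊆image-collapseOutside X)
                          (meager-preimage-withHead true meager)
  ... | inj₂ improper = ⊥-elim (improper (image-collapseOutside-proper em X pos))

  weaklyHereditarilyMeager : ExcludedMiddle → Proper F → HereditarilyMeager F →
    WeaklyHereditarilyMeager F
  weaklyHereditarilyMeager em prF hm f with em (∃[ i ] Positive F (fibre f i))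
  ... | yes positive = inj₁ positive
  ... | no noPositive with hm f
  ...   | inj₁ meager   = inj₂ meager
  ...   | inj₂ improper = ⊥-elim (improper
            (image-proper-if-tendsto-∞ prF f (tendsto-∞-if-fibres-null f null)))
    where
    null : ∀ i → F (complement (fibre f i))
    null i = decidable-stable (em _) λ notInF → noPositive (i , notInF)

mainTheorem9 : ExcludedMiddle → (F : Family) → IsFilter F → Proper F →
    HereditarilyMeager F → CompletelyMeager F × WeaklyHereditarilyMeager F
mainTheorem9 em F isF prF hm =
  completelyMeager isF em hm , weaklyHereditarilyMeager isF em prF hm
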